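{- Let $\mathcal{F}$ be a set of $k$-MOFS$(n;n/m)$, let $d$ be a positive integer, and let $\mathcal{F}'$ be the $d$-dilation of $\mathcal{F}$. If $\mathcal{F}'$ is maximal, then $\mathcal{F}$ is maximal and $d\not\equiv0\pmod m$.
   Context: A frequency square of type $(n;\lambda)$ is an $n\times n$ array on symbols $\{0,\dots,n/\lambda-1\}$ in which each symbol occurs $\lambda$ times in each row and each column; two such squares are orthogonal if, superimposed, each ordered pair of symbols occurs $\lambda^2$ times. A set of $k$-MOFS$(n;\lambda)$ is a set of $k$ pairwise orthogonal such squares; it is maximal if no frequency square of type $(n;\lambda)$ is orthogonal to every member. The $d$-dilation of a set of $k$-MOFS$(n;n/m)$ is the set of $k$-MOFS$(dn;dn/m)$ obtained by replacing every entry $e$ of every square by a $d\times d$ block all of whose entries equal $e$. -}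

module Defs where
open import Data.Nat using (ℕ; _*_)
open import Data.Fin using (Fin; _≟_; quotient)
open import Data.List using (List; length; filter; map; allFin)
open import Data.Nat.ListAction using (sum)
open import Data.Product using (_×_; Σ)
open import Relation.Binary.PropositionalEquality using (_≡_)
open import Relation.Nullary using (¬_)

Array : ℕ → ℕ → Set
Array n m = Fin n → Fin n → Fin m

rowCount : ∀ {n m} → Array n m → Fin n → Fin m → ℕ
rowCount {n} L i s = length (filter (\ j → L i j ≟ s) (allFin n))

colCount : ∀ {n m} → Array n m → Fin n → Fin m → ℕ
colCount {n} L j s = length (filter (\ i → L i j ≟ s) (allFin n))

-- Frequency square of type (n;λ) whose symbol set is Fin m (m = n/λ):
-- each symbol occurs μ times in each row and each column.
IsFreqSquare : ∀ n m → ℕ → Array n m → Set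
IsFreqSquare n m μ L = (∀ i s → rowCount L i s ≡ μ) × (∀ j s → colCount L j s ≡ μ)

pairCount : ∀ {n m} → Array n m → Array n m → Fin m → Fin m → ℕ
pairCount {n} L₁ L₂ a b =
  sum (map (\ i → length (filter (\ j → L₁ i j ≟ a) (filter (\ j → L₂ i j ≟ b) (allFin n)))) (allFin n))

Orthogonal : ∀ {n m} → ℕ → Array n m → Array n m → Set
Orthogonal {m = m} μ L₁ L₂ = ∀ (a b : Fin m) → pairCount L₁ L₂ a b ≡ μ * μ

IsMOFS : ∀ n m k → ℕ → (Fin k → Array n m) → Set
IsMOFS n m k μ F =
  (∀ r → IsFreqSquare n m μ (F r)) × (∀ r s → ¬ (r ≡ s) → Orthogonal μ (F r) (F s))

IsMaximal : ∀ n m k → ℕ → (Fin k → Array n m) → Set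
IsMaximal n m k μ F =
  IsMOFS n m k μ F × ¬ (Σ (Array n m) (\ L → IsFreqSquare n m μ L × (∀ r → Orthogonal μ L (F r))))

Family : ℕ → ℕ → ℕ → Set
Family k n m = Fin k → Array n m

-- d-dilation: each entry replaced by a d×d block (cell (i,j) of the dilated
-- square of size n*d lies in block (i div d , j div d)).
dilate : ∀ {n m k} (d : ℕ) → (Fin k → Array n m) → Fin k → Array (n * d) m
dilate d F r i j = F r (quotient d i) (quotient d j)

-- A frequency square orthogonal to every member of F dilates to one orthogonal to
-- every member of F′, so maximality of F′ forces maximality of F.  If m ∣ d, the
-- array (i , j) ↦ (i + j) mod m of order n d meets every d×d block of F′, on which
-- F′ is constant, in each symbol equally often; it is therefore a frequency square
-- orthogonal to all of F′, so F′ is not maximal.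
module Submission where

open import Defs
open import Data.Fin using (Fin; zero; suc; toℕ; combine; quotient; remainder; _↑ˡ_; _↑ʳ_; _≟_)
open import Data.Fin.Permutation using (Permutation; permutation)
open import Data.Fin.Properties using (remQuot-combine; toℕ-injective; toℕ-fromℕ<; toℕ<n)
open import Data.List using (length; filter; map; tabulate)
open import Data.Nat using (ℕ; zero; suc; _+_; _*_; _∸_; _/_; _%_; NonZero)
open import Data.Nat.DivMod using (_mod_; %-distribˡ-+; m%n%n≡m%n; [m+n]%n≡m%n; m<n⇒m%n≡m; m/n*n≡m; *-/-assoc)
open import Data.Nat.Divisibility using (_∣_; divides)
open import Data.Nat.Properties using (+-*-semiring; +-assoc; +-comm; *-comm; <⇒≤; m+[n∸m]≡n; m∸n+n≡m)
open import Data.Nat.Solver using (module +-*-Solver)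
open +-*-Solver using (solve; _:=_; _:*_; con)
open import Data.Bool using (true; false; if_then_else_)
open import Data.Product using (_×_; _,_; proj₁; proj₂; Σ; uncurry)
open import Function using (_∘_; id)
open import Relation.Nullary using (¬_; Dec; does)
open import Relation.Unary using (Pred; Decidable)
open import Relation.Binary.PropositionalEquality using (_≡_; refl; sym; trans; cong; cong₂; subst; module ≡-Reasoning)
import Data.Nat.ListAction as List
open import Algebra.Properties.Semiring.Sum +-*-semiring
  using (sum-syntax; sum-cong-≗; sum-replicate-zero; ∑-comm; ∑-permute; *-distribˡ-sum; *-distribʳ-sum)

open ≡-Reasoning

𝟙 : ∀ {p} {P : Set p} → Dec P → ℕ
𝟙 P? = if does P? then 1 else 0

∑-const : ∀ n x → ∑[ i < n ] x ≡ n * x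
∑-const zero    x = refl
∑-const (suc n) x = cong (x +_) (∑-const n x)

∑-↑ : ∀ a b (f : Fin (a + b) → ℕ) →
  ∑[ k < a + b ] f k ≡ ∑[ i < a ] f (i ↑ˡ b) + ∑[ j < b ] f (a ↑ʳ j)
∑-↑ zero    b f = refl
∑-↑ (suc a) b f = trans (cong (f zero +_) (∑-↑ a b (f ∘ suc))) (sym (+-assoc (f zero) _ _))

∑-combine : ∀ n d (f : Fin (n * d) → ℕ) →
  ∑[ k < n * d ] f k ≡ ∑[ i < n ] ∑[ j < d ] f (combine i j)
∑-combine zero    d f = refl
∑-combine (suc n) d f =
  trans (∑-↑ d (n * d) f) (cong (∑[ j < d ] f (j ↑ˡ n * d) +_) (∑-combine n d (f ∘ (d ↑ʳ_))))

∑-remQuot : ∀ n d (f : Fin n → Fin d → ℕ) →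
  ∑[ k < n * d ] f (quotient d k) (remainder {n} d k) ≡ ∑[ i < n ] ∑[ j < d ] f i j
∑-remQuot n d f = trans (∑-combine n d _)
  (sum-cong-≗ λ i → sum-cong-≗ λ j → cong (uncurry f) (remQuot-combine i j))

∑-quotient : ∀ n d (f : Fin n → ℕ) → ∑[ k < n * d ] f (quotient d k) ≡ d * ∑[ i < n ] f i
∑-quotient n d f = begin
  ∑[ k < n * d ] f (quotient d k)  ≡⟨ ∑-remQuot n d (λ i _ → f i) ⟩
  ∑[ i < n ] ∑[ j < d ] f i        ≡⟨ sum-cong-≗ (λ i → ∑-const d (f i)) ⟩
  ∑[ i < n ] (d * f i)             ≡⟨ *-distribˡ-sum d f ⟨
  d * ∑[ i < n ] f i               ∎

∑-remainder : ∀ n d (f : Fin d → ℕ) → ∑[ k < n * d ] f (remainder {n} d k) ≡ n * ∑[ j < d ] f j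
∑-remainder n d f = trans (∑-remQuot n d (λ _ j → f j)) (∑-const n _)

∑∑-quotient : ∀ n d (f : Fin n → Fin n → ℕ) →
  ∑[ i < n * d ] ∑[ j < n * d ] f (quotient d i) (quotient d j) ≡ d * (d * ∑[ i < n ] ∑[ j < n ] f i j)
∑∑-quotient n d f = begin
  ∑[ i < n * d ] ∑[ j < n * d ] f (quotient d i) (quotient d j)
    ≡⟨ sum-cong-≗ (λ i → ∑-quotient n d (f (quotient d i))) ⟩
  ∑[ i < n * d ] (d * ∑[ J < n ] f (quotient d i) J)
    ≡⟨ ∑-quotient n d (λ I → d * ∑[ J < n ] f I J) ⟩
  d * ∑[ I < n ] (d * ∑[ J < n ] f I J)
    ≡⟨ cong (d *_) (*-distribˡ-sum d (λ I → ∑[ J < n ] f I J)) ⟨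
  d * (d * ∑[ i < n ] ∑[ j < n ] f i j) ∎

∑∑-remQuot-separable : ∀ n d (u : Fin n → Fin n → ℕ) (v : Fin d → Fin d → ℕ) →
  ∑[ i < n * d ] ∑[ j < n * d ]
    (u (quotient d i) (quotient d j) * v (remainder {n} d i) (remainder {n} d j))
  ≡ (∑[ I < n ] ∑[ J < n ] u I J) * (∑[ i < d ] ∑[ j < d ] v i j)
∑∑-remQuot-separable n d u v = begin
  ∑[ i < n * d ] ∑[ j < n * d ] (u (quotient d i) (quotient d j) * v (remainder {n} d i) (remainder {n} d j))
    ≡⟨ ∑-remQuot n d (λ I i → ∑[ j < n * d ] (u I (quotient d j) * v i (remainder {n} d j))) ⟩
  ∑[ I < n ] ∑[ i < d ] ∑[ j < n * d ] (u I (quotient d j) * v i (remainder {n} d j))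
    ≡⟨ sum-cong-≗ (λ I → sum-cong-≗ λ i → ∑-remQuot n d (λ J j → u I J * v i j)) ⟩
  ∑[ I < n ] ∑[ i < d ] ∑[ J < n ] ∑[ j < d ] (u I J * v i j)
    ≡⟨ sum-cong-≗ (λ I → ∑-comm (λ i J → ∑[ j < d ] (u I J * v i j))) ⟩
  ∑[ I < n ] ∑[ J < n ] ∑[ i < d ] ∑[ j < d ] (u I J * v i j)
    ≡⟨ sum-cong-≗ (λ I → sum-cong-≗ λ J → factorˡ (u I J)) ⟩
  ∑[ I < n ] ∑[ J < n ] (u I J * V)
    ≡⟨ sum-cong-≗ (λ I → *-distribʳ-sum V (u I)) ⟨
  ∑[ I < n ] ((∑[ J < n ] u I J) * V)
    ≡⟨ *-distribʳ-sum V (λ I → ∑[ J < n ] u I J) ⟨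
  (∑[ I < n ] ∑[ J < n ] u I J) * V ∎
  where
  V : ℕ
  V = ∑[ i < d ] ∑[ j < d ] v i j
  factorˡ : ∀ x → ∑[ i < d ] ∑[ j < d ] (x * v i j) ≡ x * V
  factorˡ x = trans (sum-cong-≗ λ i → sym (*-distribˡ-sum x (v i))) (sym (*-distribˡ-sum x (λ i → ∑[ j < d ] v i j)))

∑-𝟙-≟ : ∀ {m} (s : Fin m) → ∑[ k < m ] 𝟙 (k ≟ s) ≡ 1
∑-𝟙-≟ {suc m} zero    = cong suc (sum-replicate-zero m)
∑-𝟙-≟ {suc m} (suc s) = ∑-𝟙-≟ s

length-filter-tabulate : ∀ {A : Set} {p} {P : Pred A p} (P? : Decidable P) {n} (f : Fin n → A) →
  length (filter P? (tabulate f)) ≡ ∑[ i < n ] 𝟙 (P? (f i))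
length-filter-tabulate P? {zero}  f = refl
length-filter-tabulate P? {suc n} f with does (P? (f zero))
... | true  = cong suc (length-filter-tabulate P? (f ∘ suc))
... | false = length-filter-tabulate P? (f ∘ suc)

length-filter-filter-tabulate : ∀ {A : Set} {p q} {P : Pred A p} {Q : Pred A q}
  (P? : Decidable P) (Q? : Decidable Q) {n} (f : Fin n → A) →
  length (filter P? (filter Q? (tabulate f))) ≡ ∑[ i < n ] (𝟙 (Q? (f i)) * 𝟙 (P? (f i)))
length-filter-filter-tabulate P? Q? {zero}  f = refl
length-filter-filter-tabulate P? Q? {suc n} f with does (Q? (f zero))
... | false = length-filter-filter-tabulate P? Q? (f ∘ suc)
... | true with does (P? (f zero))
...   | true  = cong suc (length-filter-filter-tabulate P? Q? (f ∘ suc))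
...   | false = length-filter-filter-tabulate P? Q? (f ∘ suc)

sum-map-tabulate : ∀ {A : Set} (h : A → ℕ) {n} (f : Fin n → A) →
  List.sum (map h (tabulate f)) ≡ ∑[ i < n ] h (f i)
sum-map-tabulate h {zero}  f = refl
sum-map-tabulate h {suc n} f = cong (h (f zero) +_) (sum-map-tabulate h (f ∘ suc))

module _ {n m : ℕ} where

  rowCount-∑ : ∀ (L : Array n m) i s → rowCount L i s ≡ ∑[ j < n ] 𝟙 (L i j ≟ s)
  rowCount-∑ L i s = length-filter-tabulate (λ j → L i j ≟ s) id

  colCount-∑ : ∀ (L : Array n m) j s → colCount L j s ≡ ∑[ i < n ] 𝟙 (L i j ≟ s)
  colCount-∑ L j s = length-filter-tabulate (λ i → L i j ≟ s) id

  pairCount-∑ : ∀ (L₁ L₂ : Array n m) a b →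
    pairCount L₁ L₂ a b ≡ ∑[ i < n ] ∑[ j < n ] (𝟙 (L₂ i j ≟ b) * 𝟙 (L₁ i j ≟ a))
  pairCount-∑ L₁ L₂ a b = trans (sum-map-tabulate _ {n} id)
    (sum-cong-≗ λ i → length-filter-filter-tabulate (λ j → L₁ i j ≟ a) (λ j → L₂ i j ≟ b) id)

  symbolCount : Array n m → Fin m → ℕ
  symbolCount L s = ∑[ i < n ] ∑[ j < n ] 𝟙 (L i j ≟ s)

  isFreqSquare⇒symbolCount : ∀ {μ L} → IsFreqSquare n m μ L → ∀ s → symbolCount L s ≡ n * μ
  isFreqSquare⇒symbolCount {μ} {L} (rows , _) s =
    trans (sum-cong-≗ λ i → trans (sym (rowCount-∑ L i s)) (rows i s)) (∑-const n μ)

dilateArray : ∀ {n m} d → Array n m → Array (n * d) m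
dilateArray d A i j = A (quotient d i) (quotient d j)

tile : ∀ {d m} n → Array d m → Array (n * d) m
tile {d} n C i j = C (remainder {n} d i) (remainder {n} d j)

module _ {n m : ℕ} (d : ℕ) where

  dilate-isFreqSquare : ∀ {μ A} → IsFreqSquare n m μ A → IsFreqSquare (n * d) m (d * μ) (dilateArray d A)
  dilate-isFreqSquare {μ} {A} (rows , cols) = row , col
    where
    row : ∀ i s → rowCount (dilateArray d A) i s ≡ d * μ
    row i s = begin
      rowCount (dilateArray d A) i s          ≡⟨ rowCount-∑ (dilateArray d A) i s ⟩
      ∑[ j < n * d ] 𝟙 (A (quotient d i) (quotient d j) ≟ s)
                                              ≡⟨ ∑-quotient n d (λ J → 𝟙 (A (quotient d i) J ≟ s)) ⟩
      d * ∑[ J < n ] 𝟙 (A (quotient d i) J ≟ s) ≡⟨ cong (d *_) (sym (rowCount-∑ A (quotient d i) s)) ⟩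
      d * rowCount A (quotient d i) s         ≡⟨ cong (d *_) (rows (quotient d i) s) ⟩
      d * μ                                   ∎
    col : ∀ j s → colCount (dilateArray d A) j s ≡ d * μ
    col j s = begin
      colCount (dilateArray d A) j s          ≡⟨ colCount-∑ (dilateArray d A) j s ⟩
      ∑[ i < n * d ] 𝟙 (A (quotient d i) (quotient d j) ≟ s)
                                              ≡⟨ ∑-quotient n d (λ I → 𝟙 (A I (quotient d j) ≟ s)) ⟩
      d * ∑[ I < n ] 𝟙 (A I (quotient d j) ≟ s) ≡⟨ cong (d *_) (sym (colCount-∑ A (quotient d j) s)) ⟩
      d * colCount A (quotient d j) s         ≡⟨ cong (d *_) (cols (quotient d j) s) ⟩
      d * μ                                   ∎

  dilate-orthogonal : ∀ {μ} {A B : Array n m} → Orthogonal μ A B →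
    Orthogonal (d * μ) (dilateArray d A) (dilateArray d B)
  dilate-orthogonal {μ} {A} {B} A⊥B a b = begin
    pairCount (dilateArray d A) (dilateArray d B) a b
      ≡⟨ pairCount-∑ (dilateArray d A) (dilateArray d B) a b ⟩
    ∑[ i < n * d ] ∑[ j < n * d ] (𝟙 (B (quotient d i) (quotient d j) ≟ b) * 𝟙 (A (quotient d i) (quotient d j) ≟ a))
      ≡⟨ ∑∑-quotient n d (λ I J → 𝟙 (B I J ≟ b) * 𝟙 (A I J ≟ a)) ⟩
    d * (d * ∑[ I < n ] ∑[ J < n ] (𝟙 (B I J ≟ b) * 𝟙 (A I J ≟ a)))
      ≡⟨ cong (λ x → d * (d * x)) (trans (sym (pairCount-∑ A B a b)) (A⊥B a b)) ⟩
    d * (d * (μ * μ))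
      ≡⟨ solve 2 (λ d μ → d :* (d :* (μ :* μ)) := (d :* μ) :* (d :* μ)) refl d μ ⟩
    (d * μ) * (d * μ) ∎

module _ {d m : ℕ} (n : ℕ) where

  tile-isFreqSquare : ∀ {μ C} → IsFreqSquare d m μ C → IsFreqSquare (n * d) m (n * μ) (tile n C)
  tile-isFreqSquare {μ} {C} (rows , cols) = row , col
    where
    row : ∀ i s → rowCount (tile n C) i s ≡ n * μ
    row i s = begin
      rowCount (tile n C) i s             ≡⟨ rowCount-∑ (tile n C) i s ⟩
      ∑[ j < n * d ] 𝟙 (C (remainder {n} d i) (remainder {n} d j) ≟ s)
                                          ≡⟨ ∑-remainder n d (λ j → 𝟙 (C (remainder {n} d i) j ≟ s)) ⟩
      n * ∑[ j < d ] 𝟙 (C (remainder {n} d i) j ≟ s)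
                                          ≡⟨ cong (n *_) (sym (rowCount-∑ C _ s)) ⟩
      n * rowCount C (remainder {n} d i) s ≡⟨ cong (n *_) (rows _ s) ⟩
      n * μ                               ∎
    col : ∀ j s → colCount (tile n C) j s ≡ n * μ
    col j s = begin
      colCount (tile n C) j s             ≡⟨ colCount-∑ (tile n C) j s ⟩
      ∑[ i < n * d ] 𝟙 (C (remainder {n} d i) (remainder {n} d j) ≟ s)
                                          ≡⟨ ∑-remainder n d (λ i → 𝟙 (C i (remainder {n} d j) ≟ s)) ⟩
      n * ∑[ i < d ] 𝟙 (C i (remainder {n} d j) ≟ s)
                                          ≡⟨ cong (n *_) (sym (colCount-∑ C _ s)) ⟩
      n * colCount C (remainder {n} d j) s ≡⟨ cong (n *_) (cols _ s) ⟩
      n * μ                               ∎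

  tile-dilate-pairCount : ∀ (C : Array d m) (A : Array n m) a b →
    pairCount (tile n C) (dilateArray d A) a b ≡ symbolCount A b * symbolCount C a
  tile-dilate-pairCount C A a b = trans (pairCount-∑ (tile n C) (dilateArray d A) a b)
    (∑∑-remQuot-separable n d (λ I J → 𝟙 (A I J ≟ b)) (λ i j → 𝟙 (C i j ≟ a)))

module _ {m : ℕ} .{{_ : NonZero m}} where

  rotate : ℕ → Fin m → Fin m
  rotate a j = (a + toℕ j) mod m

  toℕ-rotate : ∀ a j → toℕ (rotate a j) ≡ (a + toℕ j) % m
  toℕ-rotate a j = toℕ-fromℕ< _

  rotate-rotate : ∀ a b j → rotate a (rotate b j) ≡ rotate (a + b) j
  rotate-rotate a b j = toℕ-injective (begin
    toℕ (rotate a (rotate b j))       ≡⟨ toℕ-rotate a (rotate b j) ⟩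
    (a + toℕ (rotate b j)) % m        ≡⟨ cong (λ x → (a + x) % m) (toℕ-rotate b j) ⟩
    (a + (b + toℕ j) % m) % m         ≡⟨ %-distribˡ-+ a _ m ⟩
    (a % m + (b + toℕ j) % m % m) % m ≡⟨ cong (λ x → (a % m + x) % m) (m%n%n≡m%n _ m) ⟩
    (a % m + (b + toℕ j) % m) % m     ≡⟨ %-distribˡ-+ a _ m ⟨
    (a + (b + toℕ j)) % m             ≡⟨ cong (_% m) (+-assoc a b _) ⟨
    (a + b + toℕ j) % m               ≡⟨ toℕ-rotate (a + b) j ⟨
    toℕ (rotate (a + b) j)            ∎)

  rotate-by-m : ∀ j → rotate m j ≡ j
  rotate-by-m j = toℕ-injective (begin
    toℕ (rotate m j)  ≡⟨ toℕ-rotate m j ⟩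
    (m + toℕ j) % m   ≡⟨ cong (_% m) (+-comm m _) ⟩
    (toℕ j + m) % m   ≡⟨ [m+n]%n≡m%n _ m ⟩
    toℕ j % m         ≡⟨ m<n⇒m%n≡m (toℕ<n j) ⟩
    toℕ j             ∎)

  rotation : Fin m → Permutation m m
  rotation x = permutation (rotate (toℕ x)) (rotate (m ∸ toℕ x))
    (λ k → trans (rotate-rotate _ _ k) (trans (cong (λ a → rotate a k) (m+[n∸m]≡n x≤m)) (rotate-by-m k)))
    (λ j → trans (rotate-rotate _ _ j) (trans (cong (λ a → rotate a j) (m∸n+n≡m x≤m)) (rotate-by-m j)))
    where x≤m = <⇒≤ (toℕ<n x)

  rotation-count : ∀ x s → ∑[ j < m ] 𝟙 (rotate (toℕ x) j ≟ s) ≡ 1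
  rotation-count x s = trans (sym (∑-permute (λ k → 𝟙 (k ≟ s)) (rotation x))) (∑-𝟙-≟ s)

  cyclic : Array m m
  cyclic i j = rotate (toℕ i) j

  cyclic-isFreqSquare : IsFreqSquare m m 1 cyclic
  cyclic-isFreqSquare = row , col
    where
    row : ∀ i s → rowCount cyclic i s ≡ 1
    row i s = trans (rowCount-∑ cyclic i s) (rotation-count i s)
    col : ∀ j s → colCount cyclic j s ≡ 1
    col j s = begin
      colCount cyclic j s                  ≡⟨ colCount-∑ cyclic j s ⟩
      ∑[ i < m ] 𝟙 (rotate (toℕ i) j ≟ s) ≡⟨ sum-cong-≗ {m} (λ i → cong (λ x → 𝟙 ((x mod m) ≟ s)) (+-comm (toℕ i) (toℕ j))) ⟩
      ∑[ i < m ] 𝟙 (rotate (toℕ j) i ≟ s) ≡⟨ rotation-count j s ⟩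
      1                                    ∎

OrthogonalExtension : ∀ n m k → ℕ → Family k n m → Array n m → Set
OrthogonalExtension n m k μ F L = IsFreqSquare n m μ L × (∀ r → Orthogonal μ L (F r))

module _ {n m k μ : ℕ} {F : Family k n m} where

  dilate-orthogonalExtension : ∀ d {L} → OrthogonalExtension n m k μ F L →
    OrthogonalExtension (n * d) m k (d * μ) (dilate d F) (dilateArray d L)
  dilate-orthogonalExtension d {L} (isFreq , L⊥F) =
    dilate-isFreqSquare d isFreq , λ r → dilate-orthogonal d {μ} {L} {F r} (L⊥F r)

  dilate-reflects-maximality : ∀ d → IsMOFS n m k μ F →
    IsMaximal (n * d) m k (d * μ) (dilate d F) → IsMaximal n m k μ F
  dilate-reflects-maximality d isMOFS (_ , inextensible) =
    isMOFS , λ (L , ext) → inextensible (dilateArray d L , dilate-orthogonalExtension d ext)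

  dilate-by-multiple-extendable : ∀ {d} .{{_ : NonZero m}} → n ≡ μ * m → m ∣ d →
    (∀ r → IsFreqSquare n m μ (F r)) →
    Σ (Array (n * d) m) (OrthogonalExtension (n * d) m k (d * μ) (dilate d F))
  dilate-by-multiple-extendable refl (divides e refl) isFreq = L , isFreqL , L⊥F
    where
    C : Array (e * m) m
    C = tile e cyclic
    isFreqC : IsFreqSquare (e * m) m (e * 1) C
    isFreqC = tile-isFreqSquare e cyclic-isFreqSquare
    L : Array (μ * m * (e * m)) m
    L = tile (μ * m) C
    isFreqL : IsFreqSquare (μ * m * (e * m)) m (e * m * μ) L
    isFreqL = subst (λ ν → IsFreqSquare _ m ν L)
      (solve 3 (λ μ m e → μ :* m :* (e :* con 1) := e :* m :* μ) refl μ m e)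
      (tile-isFreqSquare (μ * m) isFreqC)
    L⊥F : ∀ r → Orthogonal (e * m * μ) L (dilate (e * m) F r)
    L⊥F r a b = begin
      pairCount L (dilateArray (e * m) (F r)) a b
        ≡⟨ tile-dilate-pairCount (μ * m) C (F r) a b ⟩
      symbolCount (F r) b * symbolCount C a
        ≡⟨ cong₂ _*_ (isFreqSquare⇒symbolCount (isFreq r) b) (isFreqSquare⇒symbolCount isFreqC a) ⟩
      (μ * m * μ) * (e * m * (e * 1))
        ≡⟨ solve 3 (λ μ m e → μ :* m :* μ :* (e :* m :* (e :* con 1)) := e :* m :* μ :* (e :* m :* μ)) refl μ m e ⟩
      (e * m * μ) * (e * m * μ) ∎

-- The hypothesis d ≠ 0 is unused: d = 0 falls under the case m ∣ d.
lemma2p3 : ∀ (n m k d : ℕ) .{{_ : NonZero m}} → m ∣ n → NonZero d →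
    (F : Family k n m) → IsMOFS n m k (n / m) F →
    IsMaximal (n * d) m k ((n * d) / m) (dilate d F) →
    IsMaximal n m k (n / m) F × ¬ (m ∣ d)
lemma2p3 n m k d m∣n _ F isMOFS maximal′ = dilate-reflects-maximality d isMOFS maximal , m∤d
  where
  maximal : IsMaximal (n * d) m k (d * (n / m)) (dilate d F)
  maximal = subst (λ μ → IsMaximal (n * d) m k μ (dilate d F))
    (trans (cong (_/ m) (*-comm n d)) (*-/-assoc d m∣n)) maximal′
  m∤d : ¬ m ∣ d
  m∤d m∣d = proj₂ maximal (dilate-by-multiple-extendable (sym (m/n*n≡m m∣n)) m∣d (proj₁ isMOFS))
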